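{- Let $\mathcal{K}$ be a simplicial complex with vertex set $V$, let $f,g:V\to\mathbb{R}$ be arbitrary, and let $h:V\to\mathbb{R}$ be nowhere zero. Then the map $\varphi$ given on $n$-chains by $\varphi\big(\sum x_{\{v_0,\dots,v_n\}}\{v_0,\dots,v_n\}\big)=\sum \frac{x_{\{v_0,\dots,v_n\}}}{h(v_0)\cdots h(v_n)}\{v_0,\dots,v_n\}$ is a chain isomorphism from $(C_*(\mathcal{K}^\times_g;\mathbb{R}),\partial^f_*)$ to $(C_*(\mathcal{K}^\times_g;\mathbb{R}),\partial^{fh}_*)$ which in each degree is an isometry with respect to the inner products $\langle\,,\rangle_g$ and $\langle\,,\rangle_{gh}$.
   Context: $V$ is finite and totally ordered; simplices are written $\{v_0,\dots,v_n\}$ with $v_0\prec\dots\prec v_n$; $C_n$ has basis the $n$-simplices. For $F:V\to\mathbb{R}$, $F(\sigma)=\prod_iF(v_i)$; $fh$, $gh$ are pointwise products. $\partial_n^F\{v_0,\dots,v_n\}=\sum_i(-1)^iF(v_i)\{v_0,\dots,\widehat{v_i},\dots,v_n\}$; $\langle\sigma,\tau\rangle_G=G(\sigma)G(\tau)\delta(\sigma,\tau)$. $\mathcal{K}^\times_g=\{\sigma\in\mathcal{K}:g(\sigma)\neq0\}$ is the largest subcomplex of $\mathcal{K}$ on whose vertices $g$ is nonzero; $\partial^F$ maps its chains to its chains, and on $C_n(\mathcal{K}^\times_g;\mathbb{R})$ both $\langle\,,\rangle_g$ and $\langle\,,\rangle_{gh}$ are inner products. -}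

module Defs where

open import Level using (Level; _⊔_) renaming (suc to lsuc)
open import Data.Nat using (ℕ; zero; suc)
open import Data.Bool using (Bool; true; false; if_then_else_)
import Data.Bool as Bool
open import Data.Fin using (Fin; zero; suc)
open import Data.Fin.Subset using (Subset; _⊆_; Nonempty; ⁅_⁆; ∣_∣)
open import Data.Vec using (Vec; []; _∷_)
open import Data.Vec.Properties using (≡-dec)
open import Data.List using (List; []; _∷_; map; _++_; foldr)
open import Data.Product using (_×_; _,_; ∃)
open import Relation.Nullary using (¬_; does)
open import Relation.Binary.PropositionalEquality using (_≡_)
open import Algebra.Bundles using (CommutativeRing)

-- A field: a commutative ring with 0 ≠ 1 and a (total) inverse operation
-- which is a genuine multiplicative inverse on nonzero elements.
-- (The paper works over ℝ, which is such a field.)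
record Field (c ℓ : Level) : Set (lsuc (c ⊔ ℓ)) where
  field
    commutativeRing : CommutativeRing c ℓ
  open CommutativeRing commutativeRing public
  field
    _⁻¹      : Carrier → Carrier
    0≉1      : ¬ (0# ≈ 1#)
    inverseʳ : ∀ x → ¬ (x ≈ 0#) → x * (x ⁻¹) ≈ 1#

-- Vertex set V = Fin m with its natural total order.  A simplex is a
-- nonempty subset σ of V; its vertices listed in increasing order are
-- v₀ ≺ … ≺ vₙ where n + 1 = ∣ σ ∣.
record SimplicialComplex (m : ℕ) : Set₁ where
  field
    _∈K_       : Subset m → Set
    nonempty   : ∀ {σ} → _∈K_ σ → Nonempty σ
    downClosed : ∀ {σ τ} → _∈K_ σ → τ ⊆ σ → Nonempty τ → _∈K_ τ
    vertices   : ∀ v → _∈K_ (⁅ v ⁆)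

allSubsets : (m : ℕ) → List (Subset m)
allSubsets zero    = [] ∷ []
allSubsets (suc m) = map (false ∷_) (allSubsets m) ++ map (true ∷_) (allSubsets m)

-- The faces of σ = {v₀,…,vₙ}: triples (i , vᵢ , {v₀,…,v̂ᵢ,…,vₙ})
faces : ∀ {m} → Subset m → List (ℕ × Fin m × Subset m)
faces []          = []
faces (false ∷ σ) = map (λ { (k , v , τ) → (k , suc v , false ∷ τ) }) (faces σ)
faces (true ∷ σ)  = (0 , zero , false ∷ σ)
                  ∷ map (λ { (k , v , τ) → (suc k , suc v , true ∷ τ) }) (faces σ)

module _ {c ℓ} (𝔽 : Field c ℓ) where
  open Field 𝔽 hiding (zero)

  Σ[_] : ∀ {a} {A : Set a} → List A → (A → Carrier) → Carrier
  Σ[ xs ] t = foldr (λ x r → t x + r) 0# xs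

  signed : ℕ → Carrier → Carrier
  signed zero    x = x
  signed (suc k) x = - signed k x

  ∏ : ∀ {m} → (Fin m → Carrier) → Subset m → Carrier
  ∏ F []          = 1#
  ∏ F (false ∷ σ) = ∏ (λ i → F (suc i)) σ
  ∏ F (true ∷ σ)  = F zero * ∏ (λ i → F (suc i)) σ

  _·_ : ∀ {m} → (Fin m → Carrier) → (Fin m → Carrier) → Fin m → Carrier
  (F · G) v = F v * G v

  -- Chains are coefficient functions on simplices (the basis of C_n).
  Chain : ℕ → Set c
  Chain m = Subset m → Carrier

  δ : ∀ {m} → Subset m → Subset m → Carrier
  δ τ τ' = if does (≡-dec Bool._≟_ τ τ') then 1# else 0#

  -- ∂^F on a basis simplex σ: Σ_i (-1)^i F(v_i) {v_0,…,v̂_i,…,v_n},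
  -- given as its coefficient function
  ∂basis : ∀ {m} → (Fin m → Carrier) → Subset m → Chain m
  ∂basis F σ τ' = Σ[ faces σ ] (λ { (i , v , τ) → signed i (F v) * δ τ τ' })

  ∂ : ∀ {m} → (Fin m → Carrier) → Chain m → Chain m
  ∂ F x τ' = Σ[ allSubsets _ ] (λ σ → x σ * ∂basis F σ τ')

  InKg× : ∀ {m} → SimplicialComplex m → (Fin m → Carrier) → ℕ → Subset m → Set ℓ
  InKg× K g n σ = SimplicialComplex._∈K_ K σ × ∣ σ ∣ ≡ suc n × ¬ (∏ g σ ≈ 0#)

  -- x ∈ C_n(𝒦^×_g ; 𝔽): coefficients vanish off the n-simplices of 𝒦^×_g
  IsChain : ∀ {m} → SimplicialComplex m → (Fin m → Carrier) → ℕ → Chain m → Set ℓ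
  IsChain K g n x = ∀ σ → ¬ InKg× K g n σ → x σ ≈ 0#

  -- ⟨x , y⟩_G, the bilinear extension of ⟨σ,τ⟩_G = G(σ)G(τ)δ(σ,τ)
  ⟨_,_⟩[_] : ∀ {m} → Chain m → Chain m → (Fin m → Carrier) → Carrier
  ⟨ x , y ⟩[ G ] = Σ[ allSubsets _ ] (λ σ → x σ * y σ * (∏ G σ * ∏ G σ))

  φ : ∀ {m} → (Fin m → Carrier) → Chain m → Chain m
  φ h x σ = x σ * (∏ h σ) ⁻¹

  _≋_ : ∀ {m} → Chain m → Chain m → Set ℓ
  x ≋ y = ∀ σ → x σ ≈ y σ

-- φ rescales the coefficient of σ by h(σ)⁻¹, and h is multiplicative over
-- vertices: h(σ) = h(vᵢ) h(σ ∖ vᵢ). So rescaling a face of σ by h(σ ∖ vᵢ)⁻¹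
-- is rescaling it by h(σ)⁻¹ after multiplying its coefficient f(vᵢ) by h(vᵢ),
-- which turns ∂^f into ∂^{fh}. Likewise h(σ)⁻¹ cancels against the extra
-- factor h(σ) in each of the two weights (gh)(σ) of ⟨,⟩_{gh}, and φ is
-- inverted by rescaling with h(σ).
module Submission where

open import Defs
open import Data.Nat using (ℕ; zero; suc)
open import Data.Fin using (Fin; zero; suc)
open import Data.Bool using (false; true)
import Data.Bool as Bool
open import Data.Vec using ([]; _∷_)
open import Data.Vec.Properties using (≡-dec)
open import Data.List using (List; []; _∷_)
open import Data.List.Relation.Unary.All as All using (All; []; _∷_)
open import Data.List.Relation.Unary.All.Properties using (map⁺)
open import Data.Fin.Subset using (Subset)
open import Data.Product using (_×_; ∃; _,_)
open import Relation.Nullary using (¬_; yes; no)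
import Relation.Binary.PropositionalEquality as ≡

module Rescaling {c ℓ} (𝔽 : Field c ℓ) where
  open Field 𝔽 hiding (zero)
  open import Algebra.Properties.Ring ring using (-‿distribˡ-*)
  open import Algebra.Properties.CommutativeSemigroup *-commutativeSemigroup
    using (interchange; x∙yz≈y∙xz)
  open import Algebra.Solver.CommutativeMonoid *-commutativeMonoid
    using (solve; _⊜_; _⊕_)
  open import Relation.Binary.Reasoning.Setoid setoid

  private
    variable
      m : ℕ
      a b x : Carrier

  inverseˡ : ¬ a ≈ 0# → a ⁻¹ * a ≈ 1#
  inverseˡ {a} a≉0 = trans (*-comm _ _) (inverseʳ a a≉0)

  ⁻¹-*-cancelˡ : ¬ a ≈ 0# → a ⁻¹ * (a * b) ≈ b
  ⁻¹-*-cancelˡ {a} {b} a≉0 = begin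
    a ⁻¹ * (a * b)  ≈⟨ *-assoc _ _ _ ⟨
    (a ⁻¹ * a) * b  ≈⟨ *-congʳ (inverseˡ a≉0) ⟩
    1# * b          ≈⟨ *-identityˡ b ⟩
    b               ∎

  ⁻¹-unique : ¬ a ≈ 0# → a * b ≈ 1# → b ≈ a ⁻¹
  ⁻¹-unique {a} {b} a≉0 ab≈1 = begin
    b               ≈⟨ ⁻¹-*-cancelˡ a≉0 ⟨
    a ⁻¹ * (a * b)  ≈⟨ *-congˡ ab≈1 ⟩
    a ⁻¹ * 1#       ≈⟨ *-identityʳ _ ⟩
    a ⁻¹            ∎

  *-nonzero : ¬ a ≈ 0# → ¬ b ≈ 0# → ¬ a * b ≈ 0#
  *-nonzero {a} {b} a≉0 b≉0 ab≈0 = b≉0 (begin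
    b               ≈⟨ ⁻¹-*-cancelˡ a≉0 ⟨
    a ⁻¹ * (a * b)  ≈⟨ *-congˡ ab≈0 ⟩
    a ⁻¹ * 0#       ≈⟨ zeroʳ _ ⟩
    0#              ∎)

  x*a⁻¹*a≈x : ¬ a ≈ 0# → x * a ⁻¹ * a ≈ x
  x*a⁻¹*a≈x {a} {x} a≉0 = begin
    x * a ⁻¹ * a    ≈⟨ *-assoc _ _ _ ⟩
    x * (a ⁻¹ * a)  ≈⟨ *-congˡ (inverseˡ a≉0) ⟩
    x * 1#          ≈⟨ *-identityʳ x ⟩
    x               ∎

  x*a*a⁻¹≈x : ¬ a ≈ 0# → x * a * a ⁻¹ ≈ x
  x*a*a⁻¹≈x {a} {x} a≉0 = begin
    x * a * a ⁻¹    ≈⟨ *-assoc _ _ _ ⟩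
    x * (a * a ⁻¹)  ≈⟨ *-congˡ (inverseʳ a a≉0) ⟩
    x * 1#          ≈⟨ *-identityʳ x ⟩
    x               ∎

  ∏-nonzero : (F : Fin m → Carrier) → (∀ v → ¬ F v ≈ 0#) → ∀ σ → ¬ ∏ 𝔽 F σ ≈ 0#
  ∏-nonzero F F≉0 []          = λ 1≈0 → 0≉1 (sym 1≈0)
  ∏-nonzero F F≉0 (false ∷ σ) = ∏-nonzero (λ v → F (suc v)) (λ v → F≉0 (suc v)) σ
  ∏-nonzero F F≉0 (true ∷ σ)  =
    *-nonzero (F≉0 zero) (∏-nonzero (λ v → F (suc v)) (λ v → F≉0 (suc v)) σ)

  ∏-· : (F G : Fin m → Carrier) → ∀ σ → ∏ 𝔽 (_·_ 𝔽 F G) σ ≈ ∏ 𝔽 F σ * ∏ 𝔽 G σ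
  ∏-· F G []          = sym (*-identityˡ 1#)
  ∏-· F G (false ∷ σ) = ∏-· (λ v → F (suc v)) (λ v → G (suc v)) σ
  ∏-· F G (true ∷ σ)  = begin
    (F zero * G zero) * ∏ 𝔽 (_·_ 𝔽 F′ G′) σ    ≈⟨ *-congˡ (∏-· F′ G′ σ) ⟩
    (F zero * G zero) * (∏ 𝔽 F′ σ * ∏ 𝔽 G′ σ)  ≈⟨ interchange _ _ _ _ ⟩
    (F zero * ∏ 𝔽 F′ σ) * (G zero * ∏ 𝔽 G′ σ)  ∎
    where
    F′ G′ : Fin _ → Carrier
    F′ v = F (suc v)
    G′ v = G (suc v)

  ∏-SplitsAt : (Fin m → Carrier) → Subset m → ℕ × Fin m × Subset m → Set ℓ
  ∏-SplitsAt F σ (i , v , τ) = ∏ 𝔽 F σ ≈ F v * ∏ 𝔽 F τ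

  ∏-faces : (F : Fin m → Carrier) → ∀ σ → All (∏-SplitsAt F σ) (faces σ)
  ∏-faces F []          = []
  ∏-faces F (false ∷ σ) = map⁺ (∏-faces (λ v → F (suc v)) σ)
  ∏-faces F (true ∷ σ)  = refl ∷ map⁺ (All.map (λ {face} → shift face) (∏-faces F′ σ))
    where
    F′ : Fin _ → Carrier
    F′ v = F (suc v)
    sucFace : ℕ × Fin _ × Subset _ → ℕ × Fin (suc _) × Subset (suc _)
    sucFace (i , v , τ) = suc i , suc v , true ∷ τ
    shift : ∀ face → ∏-SplitsAt F′ σ face → ∏-SplitsAt F (true ∷ σ) (sucFace face)
    shift (i , v , τ) split = trans (*-congˡ split) (x∙yz≈y∙xz _ _ _)

  Σ-cong : ∀ {a} {A : Set a} (xs : List A) {t t′ : A → Carrier} →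
           All (λ x → t x ≈ t′ x) xs → Σ[_] 𝔽 xs t ≈ Σ[_] 𝔽 xs t′
  Σ-cong []       []       = refl
  Σ-cong (x ∷ xs) (p ∷ ps) = +-cong p (Σ-cong xs ps)

  Σ-distribʳ : ∀ {a} {A : Set a} (xs : List A) (t : A → Carrier) c →
               Σ[_] 𝔽 xs t * c ≈ Σ[_] 𝔽 xs (λ x → t x * c)
  Σ-distribʳ []       t c = zeroˡ c
  Σ-distribʳ (x ∷ xs) t c = trans (distribʳ c _ _) (+-congˡ (Σ-distribʳ xs t c))

  Σ-distribˡ : ∀ {a} {A : Set a} (xs : List A) (t : A → Carrier) c →
               c * Σ[_] 𝔽 xs t ≈ Σ[_] 𝔽 xs (λ x → c * t x)
  Σ-distribˡ []       t c = zeroʳ c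
  Σ-distribˡ (x ∷ xs) t c = trans (distribˡ c _ _) (+-congˡ (Σ-distribˡ xs t c))

  signed-*ʳ : ∀ k a b → signed 𝔽 k a * b ≈ signed 𝔽 k (a * b)
  signed-*ʳ zero    a b = refl
  signed-*ʳ (suc k) a b = trans (sym (-‿distribˡ-* _ _)) (-‿cong (signed-*ʳ k a b))

  δ-subst : (w : Subset m → Carrier) → ∀ τ τ′ → δ 𝔽 τ τ′ * w τ′ ≈ δ 𝔽 τ τ′ * w τ
  δ-subst w τ τ′ with ≡-dec Bool._≟_ τ τ′
  ... | yes ≡.refl = refl
  ... | no _     = trans (zeroˡ _) (sym (zeroˡ _))

  φ⁻¹ : (Fin m → Carrier) → Chain 𝔽 m → Chain 𝔽 m
  φ⁻¹ h y σ = y σ * ∏ 𝔽 h σ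

  IsChain-rescale : (K : SimplicialComplex m) (g : Fin m → Carrier) → ∀ n
                    (w : Subset m → Carrier) (x : Chain 𝔽 m) →
                    IsChain 𝔽 K g n x → IsChain 𝔽 K g n (λ σ → x σ * w σ)
  IsChain-rescale K g n w x x∈C σ σ∉K = trans (*-congʳ (x∈C σ σ∉K)) (zeroˡ _)

  ∂basis-φ : (f h : Fin m → Carrier) → (∀ v → ¬ h v ≈ 0#) → ∀ σ τ′ →
             ∂basis 𝔽 f σ τ′ * ∏ 𝔽 h τ′ ⁻¹ ≈ ∏ 𝔽 h σ ⁻¹ * ∂basis 𝔽 (_·_ 𝔽 f h) σ τ′
  ∂basis-φ f h h≉0 σ τ′ = begin
    Σ[_] 𝔽 (faces σ) _ * H⁻¹ τ′                  ≈⟨ Σ-distribʳ (faces σ) _ _ ⟩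
    Σ[_] 𝔽 (faces σ) _                          ≈⟨ Σ-cong (faces σ) (All.map (λ {face} → rescaleFace face) (∏-faces h σ)) ⟩
    Σ[_] 𝔽 (faces σ) (λ face → H⁻¹ σ * _)       ≈⟨ Σ-distribˡ (faces σ) _ _ ⟨
    H⁻¹ σ * ∂basis 𝔽 (_·_ 𝔽 f h) σ τ′            ∎
    where
    H⁻¹ : Subset _ → Carrier
    H⁻¹ ρ = ∏ 𝔽 h ρ ⁻¹
    H≉0 : ∀ ρ → ¬ ∏ 𝔽 h ρ ≈ 0#
    H≉0 = ∏-nonzero h h≉0
    rescaleFace : ∀ face → ∏-SplitsAt h σ face →
      let (i , v , τ) = face in
      signed 𝔽 i (f v) * δ 𝔽 τ τ′ * H⁻¹ τ′ ≈ H⁻¹ σ * (signed 𝔽 i (f v * h v) * δ 𝔽 τ τ′)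
    rescaleFace (i , v , τ) split = begin
      s * d * H⁻¹ τ′              ≈⟨ *-assoc _ _ _ ⟩
      s * (d * H⁻¹ τ′)            ≈⟨ *-congˡ (δ-subst H⁻¹ τ τ′) ⟩
      s * (d * H⁻¹ τ)             ≈⟨ *-congˡ (*-congˡ H⁻¹τ≈H⁻¹σh) ⟩
      s * (d * (H⁻¹ σ * h v))     ≈⟨ rearrange s d (H⁻¹ σ) (h v) ⟩
      H⁻¹ σ * (s * h v * d)       ≈⟨ *-congˡ (*-congʳ (signed-*ʳ i _ _)) ⟩
      H⁻¹ σ * (signed 𝔽 i (f v * h v) * d) ∎
      where
      s d : Carrier
      s = signed 𝔽 i (f v)
      d = δ 𝔽 τ τ′
      rearrange : ∀ s d a b → s * (d * (a * b)) ≈ a * (s * b * d)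
      rearrange = solve 4 (λ s d a b → s ⊕ (d ⊕ (a ⊕ b)) ⊜ a ⊕ ((s ⊕ b) ⊕ d)) refl
      -- ⁻¹ is not assumed to respect ≈, hence ⁻¹-unique rather than rewriting ∏ h σ.
      H⁻¹τ≈H⁻¹σh : H⁻¹ τ ≈ H⁻¹ σ * h v
      H⁻¹τ≈H⁻¹σh = sym (⁻¹-unique (H≉0 τ) (begin
        ∏ 𝔽 h τ * (H⁻¹ σ * h v)  ≈⟨ x∙yz≈y∙xz _ _ _ ⟩
        H⁻¹ σ * (∏ 𝔽 h τ * h v)  ≈⟨ *-congˡ (trans (*-comm _ _) (sym split)) ⟩
        H⁻¹ σ * ∏ 𝔽 h σ          ≈⟨ inverseˡ (H≉0 σ) ⟩
        1#                       ∎))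

  φ-∂ : (f h : Fin m → Carrier) → (∀ v → ¬ h v ≈ 0#) → ∀ x →
        _≋_ 𝔽 (φ 𝔽 h (∂ 𝔽 f x)) (∂ 𝔽 (_·_ 𝔽 f h) (φ 𝔽 h x))
  φ-∂ {m} f h h≉0 x τ′ = trans (Σ-distribʳ (allSubsets m) _ _) (Σ-cong (allSubsets m) (All.universal rescale _))
    where
    rescale : ∀ σ → x σ * ∂basis 𝔽 f σ τ′ * ∏ 𝔽 h τ′ ⁻¹ ≈ x σ * ∏ 𝔽 h σ ⁻¹ * ∂basis 𝔽 (_·_ 𝔽 f h) σ τ′
    rescale σ = begin
      x σ * ∂basis 𝔽 f σ τ′ * ∏ 𝔽 h τ′ ⁻¹              ≈⟨ *-assoc _ _ _ ⟩
      x σ * (∂basis 𝔽 f σ τ′ * ∏ 𝔽 h τ′ ⁻¹)            ≈⟨ *-congˡ (∂basis-φ f h h≉0 σ τ′) ⟩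
      x σ * (∏ 𝔽 h σ ⁻¹ * ∂basis 𝔽 (_·_ 𝔽 f h) σ τ′)   ≈⟨ *-assoc _ _ _ ⟨
      x σ * ∏ 𝔽 h σ ⁻¹ * ∂basis 𝔽 (_·_ 𝔽 f h) σ τ′     ∎

  φ-φ⁻¹ : (h : Fin m → Carrier) → (∀ v → ¬ h v ≈ 0#) → ∀ y → _≋_ 𝔽 (φ 𝔽 h (φ⁻¹ h y)) y
  φ-φ⁻¹ h h≉0 y σ = x*a*a⁻¹≈x (∏-nonzero h h≉0 σ)

  φ⁻¹-φ : (h : Fin m → Carrier) → (∀ v → ¬ h v ≈ 0#) → ∀ x → _≋_ 𝔽 (φ⁻¹ h (φ 𝔽 h x)) x
  φ⁻¹-φ h h≉0 x σ = x*a⁻¹*a≈x (∏-nonzero h h≉0 σ)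

  φ-injective : (h : Fin m → Carrier) → (∀ v → ¬ h v ≈ 0#) → ∀ x y →
                _≋_ 𝔽 (φ 𝔽 h x) (φ 𝔽 h y) → _≋_ 𝔽 x y
  φ-injective h h≉0 x y φx≋φy σ = begin
    x σ               ≈⟨ φ⁻¹-φ h h≉0 x σ ⟨
    φ⁻¹ h (φ 𝔽 h x) σ  ≈⟨ *-congʳ (φx≋φy σ) ⟩
    φ⁻¹ h (φ 𝔽 h y) σ  ≈⟨ φ⁻¹-φ h h≉0 y σ ⟩
    y σ               ∎

  φ-isometry : (g h : Fin m → Carrier) → (∀ v → ¬ h v ≈ 0#) → ∀ x y →
               ⟨_,_⟩[_] 𝔽 (φ 𝔽 h x) (φ 𝔽 h y) (_·_ 𝔽 g h) ≈ ⟨_,_⟩[_] 𝔽 x y g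
  φ-isometry {m} g h h≉0 x y = Σ-cong (allSubsets m) (All.universal rescale _)
    where
    H G GH : Subset _ → Carrier
    H = ∏ 𝔽 h
    G = ∏ 𝔽 g
    GH = ∏ 𝔽 (_·_ 𝔽 g h)
    unweight : ∀ z σ → z σ * H σ ⁻¹ * GH σ ≈ z σ * G σ
    unweight z σ = begin
      z σ * H σ ⁻¹ * GH σ           ≈⟨ *-congˡ (∏-· g h σ) ⟩
      z σ * H σ ⁻¹ * (G σ * H σ)    ≈⟨ interchange _ _ _ _ ⟩
      z σ * G σ * (H σ ⁻¹ * H σ)    ≈⟨ *-congˡ (inverseˡ (∏-nonzero h h≉0 σ)) ⟩
      z σ * G σ * 1#                ≈⟨ *-identityʳ _ ⟩
      z σ * G σ                     ∎
    rescale : ∀ σ → φ 𝔽 h x σ * φ 𝔽 h y σ * (GH σ * GH σ) ≈ x σ * y σ * (G σ * G σ)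
    rescale σ = begin
      φ 𝔽 h x σ * φ 𝔽 h y σ * (GH σ * GH σ)         ≈⟨ interchange _ _ _ _ ⟩
      φ 𝔽 h x σ * GH σ * (φ 𝔽 h y σ * GH σ)         ≈⟨ *-cong (unweight x σ) (unweight y σ) ⟩
      x σ * G σ * (y σ * G σ)                       ≈⟨ interchange _ _ _ _ ⟩
      x σ * y σ * (G σ * G σ)                       ∎

open Rescaling

corollary3p8 : ∀ {c ℓ} (𝔽 : Field c ℓ) {m : ℕ} (K : SimplicialComplex m)
    (f g h : Fin m → Field.Carrier 𝔽) →
    (∀ v → ¬ Field._≈_ 𝔽 (h v) (Field.0# 𝔽)) →
    ∀ (n : ℕ) →
    (∀ x → IsChain 𝔽 K g n x → IsChain 𝔽 K g n (φ 𝔽 h x))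
    × (∀ x → IsChain 𝔽 K g (suc n) x →
    _≋_ 𝔽 (φ 𝔽 h (∂ 𝔽 f x)) (∂ 𝔽 (_·_ 𝔽 f h) (φ 𝔽 h x)))
    × (∀ x y → IsChain 𝔽 K g n x → IsChain 𝔽 K g n y →
    _≋_ 𝔽 (φ 𝔽 h x) (φ 𝔽 h y) → _≋_ 𝔽 x y)
    × (∀ y → IsChain 𝔽 K g n y →
    ∃ λ x → IsChain 𝔽 K g n x × _≋_ 𝔽 (φ 𝔽 h x) y)
    × (∀ x y → IsChain 𝔽 K g n x → IsChain 𝔽 K g n y →
    Field._≈_ 𝔽 (⟨_,_⟩[_] 𝔽 (φ 𝔽 h x) (φ 𝔽 h y) (_·_ 𝔽 g h))
    (⟨_,_⟩[_] 𝔽 x y g))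
corollary3p8 𝔽 K f g h h≉0 n =
    (λ x → IsChain-rescale 𝔽 K g n _ x)
  , (λ x _ → φ-∂ 𝔽 f h h≉0 x)
  , (λ x y _ _ → φ-injective 𝔽 h h≉0 x y)
  , (λ y y∈C → φ⁻¹ 𝔽 h y , IsChain-rescale 𝔽 K g n _ y y∈C , φ-φ⁻¹ 𝔽 h h≉0 y)
  , (λ x y _ _ → φ-isometry 𝔽 g h h≉0 x y)
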